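{- Let $p\ge 3$ be prime. For every $k\in\{1,2,\dots,p-1\}$, ${D^\ast}^k_p={D^\ast}^1_p$.
   Context: For integers $n\ge2$ and $1\le k<n$, ${D^\ast}^k_n$ denotes the number of permutations $\sigma$ of $[n]=\{1,\dots,n\}$ (one-line notation $\sigma(1)\cdots\sigma(n)$) such that $\sigma(i+1)\not\equiv\sigma(i)+k\pmod n$ for all $1\le i\le n-1$ and $\sigma(1)\not\equiv\sigma(n)+k\pmod n$. -}

module Defs where

open import Data.Nat using (ℕ; zero; suc; _+_; _≟_; NonZero)
open import Data.Nat.DivMod using (_%_)
open import Data.List using (List; []; _∷_; concatMap; map; length; filter; last; head; applyUpTo)
open import Data.Maybe using (Maybe; just; nothing)
open import Data.Bool using (Bool; true; false; _∧_; not)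
open import Relation.Nullary.Decidable using (⌊_⌋)
open import Data.Unit using (⊤)

insertions : ℕ → List ℕ → List (List ℕ)
insertions x [] = (x ∷ []) ∷ []
insertions x (y ∷ ys) = (x ∷ y ∷ ys) ∷ map (y ∷_) (insertions x ys)

-- all permutations (orderings) of a list; for a list of distinct
-- elements this lists each permutation exactly once
permutations : List ℕ → List (List ℕ)
permutations [] = [] ∷ []
permutations (x ∷ xs) = concatMap (insertions x) (permutations xs)

range1 : ℕ → List ℕ
range1 n = applyUpTo suc n

≡mod : (n : ℕ) → .{{NonZero n}} → ℕ → ℕ → Bool
≡mod n a b = ⌊ (a % n) ≟ (b % n) ⌋

noStep : (n : ℕ) → .{{NonZero n}} → ℕ → List ℕ → Bool
noStep n k [] = true
noStep n k (a ∷ []) = true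
noStep n k (a ∷ b ∷ rest) = not (≡mod n b (a + k)) ∧ noStep n k (b ∷ rest)

wrapOK : (n : ℕ) → .{{NonZero n}} → ℕ → List ℕ → Bool
wrapOK n k [] = true
wrapOK n k (a ∷ rest) with last (a ∷ rest)
... | just z = not (≡mod n a (z + k))
... | nothing = true

good : (n : ℕ) → .{{NonZero n}} → ℕ → List ℕ → Bool
good n k s = noStep n k s ∧ wrapOK n k s

-- D*^k_n : number of permutations of [n] (one-line notation) avoiding
-- σ(i+1) ≡ σ(i)+k (mod n) for 1 ≤ i ≤ n-1 and σ(1) ≡ σ(n)+k (mod n)
Dstar : (n : ℕ) → .{{NonZero n}} → ℕ → ℕ
Dstar n k = length (filter (λ s → good n k s Data.Bool.≟ true) (permutations (range1 n)))

-- Multiplication by k is a bijection on the residues modulo the prime p, and it carries the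
-- forbidden pattern σ(i+1) ≡ σ(i) + 1 to σ(i+1) ≡ σ(i) + k.  Applying x ↦ kx (taken in
-- {1, …, p}) entrywise therefore maps the permutations counted by D*¹ₚ onto those counted
-- by D*ᵏₚ.  On the enumerated list of permutations this map sends permutations [p] to
-- permutations (k·[p]), which is a rearrangement of permutations [p] because k·[p] ↭ [p].
module Submission where

open import Defs
open import Data.Bool using (Bool; true; false; not; _∧_)
import Data.Bool as Bool
open import Data.Empty using (⊥-elim)
open import Data.List using (List; []; _∷_; _++_; map; concatMap; filter; length; last)
open import Data.List.Properties
  using ( map-++; map-∘; concatMap-++; map-concatMap; concatMap-map; concatMap-cong
        ; map-applyUpTo; length-map; last-map)
open import Data.List.Membership.Propositional using (_∈_)
open import Data.List.Membership.Propositional.Properties using (∈-map⁻; ∈-∃++; ∈-applyUpTo⁺)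
open import Data.List.Relation.Unary.All as All using (All)
open import Data.List.Relation.Unary.Any using (here; there)
open import Data.List.Relation.Unary.AllPairs using (_∷_)
open import Data.List.Relation.Unary.Unique.Propositional using (Unique)
open import Data.List.Relation.Unary.Unique.Propositional.Properties using (applyUpTo⁺₁)
open import Data.List.Relation.Binary.Permutation.Propositional
open import Data.List.Relation.Binary.Permutation.Propositional.Properties
  using (++⁺ˡ; ++⁺; shift; shifts; map⁺; ∈-resp-↭; ↭-length; filter-↭)
import Data.List.Relation.Binary.Permutation.Setoid.Properties as Permutationₛ
open import Data.Maybe using (just; nothing)
open import Data.Nat
open import Data.Nat.Properties
open import Data.Nat.DivMod
open import Data.Nat.Divisibility using (_∣_; _∤_; divides; >⇒∤)
open import Data.Nat.Primality using (Prime; euclidsLemma)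
open import Data.Product using (_,_)
open import Data.Sum using (inj₁; inj₂)
open import Function using (_∘_; mk⇔)
open import Relation.Nullary using (Dec)
open import Relation.Nullary.Decidable using (⌊_⌋; does; isYes≗does; does-⇔)
open import Relation.Binary.PropositionalEquality as ≡ using (_≡_; _≢_; refl; sym; cong; cong₂; subst)

map-insertions : (f : ℕ → ℕ) (x : ℕ) (ys : List ℕ) →
  map (map f) (insertions x ys) ≡ insertions (f x) (map f ys)
map-insertions f x [] = refl
map-insertions f x (y ∷ ys) = cong ((f x ∷ f y ∷ map f ys) ∷_) (begin
  map (map f) (map (y ∷_) (insertions x ys))   ≡⟨ map-∘ (insertions x ys) ⟨
  map ((f y ∷_) ∘ map f) (insertions x ys)     ≡⟨ map-∘ (insertions x ys) ⟩
  map (f y ∷_) (map (map f) (insertions x ys)) ≡⟨ cong (map (f y ∷_)) (map-insertions f x ys) ⟩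
  map (f y ∷_) (insertions (f x) (map f ys))   ∎)
  where open ≡.≡-Reasoning

map-permutations : (f : ℕ → ℕ) (xs : List ℕ) →
  map (map f) (permutations xs) ≡ permutations (map f xs)
map-permutations f [] = refl
map-permutations f (x ∷ xs) = begin
  map (map f) (concatMap (insertions x) (permutations xs))
    ≡⟨ map-concatMap (map f) (insertions x) (permutations xs) ⟩
  concatMap (map (map f) ∘ insertions x) (permutations xs)
    ≡⟨ concatMap-cong (map-insertions f x) (permutations xs) ⟩
  concatMap (insertions (f x) ∘ map f) (permutations xs)
    ≡⟨ concatMap-map (insertions (f x)) (map f) (permutations xs) ⟨
  concatMap (insertions (f x)) (map (map f) (permutations xs))
    ≡⟨ cong (concatMap (insertions (f x))) (map-permutations f xs) ⟩
  permutations (map f (x ∷ xs)) ∎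
  where open ≡.≡-Reasoning

concatMap⁺ : {A B : Set} (f : A → List B) {xs ys : List A} →
  xs ↭ ys → concatMap f xs ↭ concatMap f ys
concatMap⁺ f refl = refl
concatMap⁺ f (prep x p) = ++⁺ˡ (f x) (concatMap⁺ f p)
concatMap⁺ f (swap x y p) = trans (shifts (f x) (f y)) (++⁺ˡ (f y) (++⁺ˡ (f x) (concatMap⁺ f p)))
concatMap⁺ f (trans p q) = trans (concatMap⁺ f p) (concatMap⁺ f q)

concatMap-insertions-map-∷ : (x z : ℕ) (ws : List (List ℕ)) →
  concatMap (insertions x) (map (z ∷_) ws) ↭
  map (x ∷_) (map (z ∷_) ws) ++ map (z ∷_) (concatMap (insertions x) ws)
concatMap-insertions-map-∷ x z [] = refl
concatMap-insertions-map-∷ x z (w ∷ ws) = prep (x ∷ z ∷ w) (begin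
  Z (insertions x w) ++ concatMap (insertions x) (map (z ∷_) ws)
    ↭⟨ ++⁺ˡ (Z (insertions x w)) (concatMap-insertions-map-∷ x z ws) ⟩
  Z (insertions x w) ++ X ++ Z (concatMap (insertions x) ws)
    ↭⟨ shifts (Z (insertions x w)) X ⟩
  X ++ Z (insertions x w) ++ Z (concatMap (insertions x) ws)
    ≡⟨ cong (X ++_) (map-++ (z ∷_) (insertions x w) (concatMap (insertions x) ws)) ⟨
  X ++ Z (insertions x w ++ concatMap (insertions x) ws) ∎)
  where
  open PermutationReasoning
  Z = map (z ∷_)
  X = map (x ∷_) (Z ws)

insertions-comm : (x y : ℕ) (zs : List ℕ) →
  concatMap (insertions x) (insertions y zs) ↭ concatMap (insertions y) (insertions x zs)
insertions-comm x y [] = swap (x ∷ y ∷ []) (y ∷ x ∷ []) refl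
insertions-comm x y (z ∷ zs) = swap (x ∷ y ∷ z ∷ zs) (y ∷ x ∷ z ∷ zs) (begin
  Y ++ concatMap (insertions x) (Z (insertions y zs))
    ↭⟨ ++⁺ˡ Y (concatMap-insertions-map-∷ x z (insertions y zs)) ⟩
  Y ++ X ++ Z (concatMap (insertions x) (insertions y zs))
    ↭⟨ shifts Y X ⟩
  X ++ Y ++ Z (concatMap (insertions x) (insertions y zs))
    ↭⟨ ++⁺ˡ X (++⁺ˡ Y (map⁺ (z ∷_) (insertions-comm x y zs))) ⟩
  X ++ Y ++ Z (concatMap (insertions y) (insertions x zs))
    ↭⟨ ++⁺ˡ X (concatMap-insertions-map-∷ y z (insertions x zs)) ⟨
  X ++ concatMap (insertions y) (Z (insertions x zs)) ∎)
  where
  open PermutationReasoning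
  Z = map (z ∷_)
  X = map (x ∷_) (Z (insertions y zs))
  Y = map (y ∷_) (Z (insertions x zs))

concatMap-insertions-comm : (x y : ℕ) (zss : List (List ℕ)) →
  concatMap (insertions x) (concatMap (insertions y) zss) ↭
  concatMap (insertions y) (concatMap (insertions x) zss)
concatMap-insertions-comm x y [] = refl
concatMap-insertions-comm x y (zs ∷ zss) = begin
  concatMap (insertions x) (insertions y zs ++ concatMap (insertions y) zss)
    ≡⟨ concatMap-++ (insertions x) (insertions y zs) _ ⟩
  concatMap (insertions x) (insertions y zs) ++ concatMap (insertions x) (concatMap (insertions y) zss)
    ↭⟨ ++⁺ (insertions-comm x y zs) (concatMap-insertions-comm x y zss) ⟩
  concatMap (insertions y) (insertions x zs) ++ concatMap (insertions y) (concatMap (insertions x) zss)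
    ≡⟨ concatMap-++ (insertions y) (insertions x zs) _ ⟨
  concatMap (insertions y) (insertions x zs ++ concatMap (insertions x) zss) ∎
  where open PermutationReasoning

permutations⁺ : {xs ys : List ℕ} → xs ↭ ys → permutations xs ↭ permutations ys
permutations⁺ refl = refl
permutations⁺ (prep x p) = concatMap⁺ (insertions x) (permutations⁺ p)
permutations⁺ {x ∷ y ∷ _} {_ ∷ _ ∷ ys} (swap x y p) =
  trans (concatMap⁺ (insertions x) (concatMap⁺ (insertions y) (permutations⁺ p)))
        (concatMap-insertions-comm x y (permutations ys))
permutations⁺ (trans p q) = trans (permutations⁺ p) (permutations⁺ q)

unique∧⊆∧length⇒↭ : {A : Set} {xs ys : List A} → Unique xs → Unique ys → length xs ≡ length ys →
  (∀ {z} → z ∈ xs → z ∈ ys) → xs ↭ ys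
unique∧⊆∧length⇒↭ {xs = []} {[]} _ _ _ _ = refl
unique∧⊆∧length⇒↭ {xs = x ∷ xs} (x∉xs ∷ xs!) ys! len xs⊆ys
  with as , bs , refl ← ∈-∃++ (xs⊆ys (here refl)) =
  trans (prep x (unique∧⊆∧length⇒↭ xs! as++bs! (suc-injective (≡.trans len (↭-length σ))) xs⊆as++bs))
        (↭-sym σ)
  where
  σ : as ++ x ∷ bs ↭ x ∷ as ++ bs
  σ = shift x as bs
  as++bs! : Unique (as ++ bs)
  as++bs! with _ ∷ u ← Permutationₛ.Unique-resp-↭ (≡.setoid _) (↭⇒↭ₛ σ) ys! = u
  xs⊆as++bs : ∀ {z} → z ∈ xs → z ∈ as ++ bs
  xs⊆as++bs z∈xs with ∈-resp-↭ σ (xs⊆ys (there z∈xs))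
  ... | here z≡x = ⊥-elim (All.lookup x∉xs z∈xs (sym z≡x))
  ... | there z∈as++bs = z∈as++bs

length-filter-map : {A B : Set} (b : B → Bool) (c : A → Bool) (f : A → B) → (∀ x → b (f x) ≡ c x) →
  (xs : List A) →
  length (filter (λ y → b y Bool.≟ true) (map f xs)) ≡ length (filter (λ x → c x Bool.≟ true) xs)
length-filter-map b c f bf≗c [] = refl
length-filter-map b c f bf≗c (x ∷ xs) rewrite bf≗c x with c x
... | true = cong suc (length-filter-map b c f bf≗c xs)
... | false = length-filter-map b c f bf≗c xs

module _ (n : ℕ) .{{_ : NonZero n}} (k k′ : ℕ) (f : ℕ → ℕ)
         (f-step : ∀ a b → ≡mod n (f b) (f a + k) ≡ ≡mod n b (a + k′)) where

  noStep-map : (s : List ℕ) → noStep n k (map f s) ≡ noStep n k′ s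
  noStep-map [] = refl
  noStep-map (a ∷ []) = refl
  noStep-map (a ∷ b ∷ s) = cong₂ _∧_ (cong not (f-step a b)) (noStep-map (b ∷ s))

  wrapOK-map : (s : List ℕ) → wrapOK n k (map f s) ≡ wrapOK n k′ s
  wrapOK-map [] = refl
  wrapOK-map (a ∷ s) rewrite last-map f (a ∷ s) with last (a ∷ s)
  ... | just z = cong not (f-step z a)
  ... | nothing = refl

  good-map : (s : List ℕ) → good n k (map f s) ≡ good n k′ s
  good-map s = cong₂ _∧_ (noStep-map s) (wrapOK-map s)

  Dstar-≡ : map f (range1 n) ↭ range1 n → Dstar n k ≡ Dstar n k′
  Dstar-≡ f[n]↭[n] = begin
    length (filter good? (permutations (range1 n)))
      ≡⟨ ↭-length (filter-↭ (good?) (permutations⁺ f[n]↭[n])) ⟨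
    length (filter good? (permutations (map f (range1 n))))
      ≡⟨ cong (length ∘ filter good?) (map-permutations f (range1 n)) ⟨
    length (filter good? (map (map f) (permutations (range1 n))))
      ≡⟨ length-filter-map (good n k) (good n k′) (map f) good-map (permutations (range1 n)) ⟩
    Dstar n k′ ∎
    where
    open ≡.≡-Reasoning
    good? : (s : List ℕ) → Dec (good n k s ≡ true)
    good? s = good n k s Bool.≟ true

range1-unique : (n : ℕ) → Unique (range1 n)
range1-unique n = applyUpTo⁺₁ suc n (λ i<j _ → <⇒≢ i<j ∘ suc-injective)

module _ {d : ℕ} .{{_ : NonZero d}} where

  %≡%⇒∣∸ : {m n : ℕ} → m % d ≡ n % d → d ∣ n ∸ m
  %≡%⇒∣∸ {m} {n} m%d≡n%d = divides (n / d ∸ m / d) (begin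
    n ∸ m                                     ≡⟨ cong₂ _∸_ (m≡m%n+[m/n]*n n d) (m≡m%n+[m/n]*n m d) ⟩
    (n % d + n / d * d) ∸ (m % d + m / d * d) ≡⟨ cong (λ r → (n % d + n / d * d) ∸ (r + m / d * d)) m%d≡n%d ⟩
    (n % d + n / d * d) ∸ (n % d + m / d * d) ≡⟨ [m+n]∸[m+o]≡n∸o (n % d) _ _ ⟩
    n / d * d ∸ m / d * d                     ≡⟨ *-distribʳ-∸ d (n / d) (m / d) ⟨
    (n / d ∸ m / d) * d                       ∎)
    where open ≡.≡-Reasoning

  ∣∸⇒%≡% : {m n : ℕ} → m ≤ n → d ∣ n ∸ m → m % d ≡ n % d
  ∣∸⇒%≡% {m} m≤n d∣n∸m = sym (≡.trans (cong (_% d) (sym (m+[n∸m]≡n m≤n))) (%-remove-+ʳ m d∣n∸m))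

  %-+-cong : {m m′ n n′ : ℕ} → m % d ≡ m′ % d → n % d ≡ n′ % d → (m + n) % d ≡ (m′ + n′) % d
  %-+-cong {m} {m′} {n} {n′} m≡m′ n≡n′ = begin
    (m + n) % d             ≡⟨ %-distribˡ-+ m n d ⟩
    (m % d + n % d) % d     ≡⟨ cong₂ (λ u v → (u + v) % d) m≡m′ n≡n′ ⟩
    (m′ % d + n′ % d) % d   ≡⟨ %-distribˡ-+ m′ n′ d ⟨
    (m′ + n′) % d           ∎
    where open ≡.≡-Reasoning

  %-*-congˡ : (k : ℕ) {m n : ℕ} → m % d ≡ n % d → (k * m) % d ≡ (k * n) % d
  %-*-congˡ k {m} {n} m≡n = begin
    (k * m) % d             ≡⟨ %-distribˡ-* k m d ⟩
    (k % d * (m % d)) % d   ≡⟨ cong (λ u → (k % d * u) % d) m≡n ⟩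
    (k % d * (n % d)) % d   ≡⟨ %-distribˡ-* k n d ⟨
    (k * n) % d             ∎
    where open ≡.≡-Reasoning

  ≡mod-cong : {m m′ n n′ : ℕ} → m % d ≡ m′ % d → n % d ≡ n′ % d → ≡mod d m n ≡ ≡mod d m′ n′
  ≡mod-cong = cong₂ (λ u v → ⌊ u ≟ v ⌋)

module _ {p : ℕ} .{{_ : NonZero p}} (p-prime : Prime p) {k : ℕ} (p∤k : p ∤ k) where

  *-cancelˡ-%-≤ : {m n : ℕ} → m ≤ n → (k * m) % p ≡ (k * n) % p → m % p ≡ n % p
  *-cancelˡ-%-≤ {m} {n} m≤n km≡kn
    with euclidsLemma k (n ∸ m) p-prime (subst (p ∣_) (sym (*-distribˡ-∸ k n m)) (%≡%⇒∣∸ km≡kn))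
  ... | inj₁ p∣k = ⊥-elim (p∤k p∣k)
  ... | inj₂ p∣n∸m = ∣∸⇒%≡% m≤n p∣n∸m

  *-cancelˡ-% : {m n : ℕ} → (k * m) % p ≡ (k * n) % p → m % p ≡ n % p
  *-cancelˡ-% {m} {n} km≡kn with ≤-total m n
  ... | inj₁ m≤n = *-cancelˡ-%-≤ m≤n km≡kn
  ... | inj₂ n≤m = sym (*-cancelˡ-%-≤ n≤m (sym km≡kn))

  ≡mod-*-cancelˡ : (m n : ℕ) → ≡mod p (k * m) (k * n) ≡ ≡mod p m n
  ≡mod-*-cancelˡ m n = begin
    ⌊ km? ⌋  ≡⟨ isYes≗does km? ⟩
    does km? ≡⟨ does-⇔ (mk⇔ *-cancelˡ-% (%-*-congˡ k)) km? m? ⟩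
    does m?  ≡⟨ isYes≗does m? ⟨
    ⌊ m? ⌋   ∎
    where
    open ≡.≡-Reasoning
    km? : Dec ((k * m) % p ≡ (k * n) % p)
    km? = (k * m) % p ≟ (k * n) % p
    m? : Dec (m % p ≡ n % p)
    m? = m % p ≟ n % p

module Representative (n : ℕ) where

  -- The representative of m modulo 1 + n in {1, …, 1 + n}.
  rep : ℕ → ℕ
  rep m = suc ((m + n) % suc n)

  rep-% : (m : ℕ) → rep m % suc n ≡ m % suc n
  rep-% m = begin
    (1 + (m + n) % suc n) % suc n
      ≡⟨ %-+-cong {m = 1} {m′ = 1} {n = (m + n) % suc n} {n′ = m + n} refl (m%n%n≡m%n (m + n) (suc n)) ⟩
    (1 + (m + n)) % suc n         ≡⟨ cong (_% suc n) (+-suc m n) ⟨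
    (m + suc n) % suc n           ≡⟨ [m+n]%n≡m%n m (suc n) ⟩
    m % suc n                     ∎
    where open ≡.≡-Reasoning

  rep-cong : {m m′ : ℕ} → m % suc n ≡ m′ % suc n → rep m ≡ rep m′
  rep-cong {m} {m′} m≡m′ = cong suc (%-+-cong {m = m} {m′ = m′} {n = n} {n′ = n} m≡m′ refl)

  rep-suc : {i : ℕ} → i < suc n → rep (suc i) ≡ suc i
  rep-suc {i} i<1+n = cong suc (begin
    (suc i + n) % suc n ≡⟨ cong (_% suc n) (+-suc i n) ⟨
    (i + suc n) % suc n ≡⟨ [m+n]%n≡m%n i (suc n) ⟩
    i % suc n           ≡⟨ m<n⇒m%n≡m i<1+n ⟩
    i                   ∎)
    where open ≡.≡-Reasoning

  rep∈range1 : (m : ℕ) → rep m ∈ range1 (suc n)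
  rep∈range1 m = ∈-applyUpTo⁺ suc (m%n<n (m + n) (suc n))

module Scaling (n : ℕ) (p-prime : Prime (suc n)) (k : ℕ) (p∤k : suc n ∤ k) where

  open Representative n

  scale : ℕ → ℕ
  scale m = rep (k * m)

  scale-% : (m : ℕ) → scale m % suc n ≡ (k * m) % suc n
  scale-% m = rep-% (k * m)

  scale-step : (a b : ℕ) → ≡mod (suc n) (scale b) (scale a + k) ≡ ≡mod (suc n) b (a + 1)
  scale-step a b = begin
    ≡mod (suc n) (scale b) (scale a + k)
      ≡⟨ ≡mod-cong {m = scale b} {m′ = k * b} {n = scale a + k} {n′ = k * (a + 1)} (scale-% b) scale[a]+k ⟩
    ≡mod (suc n) (k * b) (k * (a + 1))
      ≡⟨ ≡mod-*-cancelˡ p-prime p∤k b (a + 1) ⟩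
    ≡mod (suc n) b (a + 1) ∎
    where
    open ≡.≡-Reasoning
    scale[a]+k : (scale a + k) % suc n ≡ (k * (a + 1)) % suc n
    scale[a]+k = begin
      (scale a + k) % suc n   ≡⟨ %-+-cong {m = scale a} {m′ = k * a} {n = k} {n′ = k} (scale-% a) refl ⟩
      (k * a + k) % suc n     ≡⟨ cong (λ t → (k * a + t) % suc n) (*-identityʳ k) ⟨
      (k * a + k * 1) % suc n ≡⟨ cong (_% suc n) (*-distribˡ-+ k a 1) ⟨
      (k * (a + 1)) % suc n   ∎

  scale-suc-injective : {i j : ℕ} → i < j → j < suc n → scale (suc i) ≢ scale (suc j)
  scale-suc-injective {i} {j} i<j j<1+n scale-i≡scale-j = <⇒≢ i<j (suc-injective (begin
    suc i          ≡⟨ rep-suc (<-trans i<j j<1+n) ⟨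
    rep (suc i)    ≡⟨ rep-cong {suc i} {suc j} (*-cancelˡ-% p-prime p∤k ki≡kj) ⟩
    rep (suc j)    ≡⟨ rep-suc j<1+n ⟩
    suc j          ∎))
    where
    open ≡.≡-Reasoning
    ki≡kj : (k * suc i) % suc n ≡ (k * suc j) % suc n
    ki≡kj = ≡.trans (sym (scale-% (suc i))) (≡.trans (cong (_% suc n) scale-i≡scale-j) (scale-% (suc j)))

  scale-range1-↭ : map scale (range1 (suc n)) ↭ range1 (suc n)
  scale-range1-↭ =
    unique∧⊆∧length⇒↭ scale-unique (range1-unique (suc n)) (length-map scale (range1 (suc n))) scale∈range1
    where
    scale-unique : Unique (map scale (range1 (suc n)))
    scale-unique = subst Unique (sym (map-applyUpTo suc scale (suc n)))
                         (applyUpTo⁺₁ (scale ∘ suc) (suc n) scale-suc-injective)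
    scale∈range1 : {z : ℕ} → z ∈ map scale (range1 (suc n)) → z ∈ range1 (suc n)
    scale∈range1 z∈ with x , _ , refl ← ∈-map⁻ scale z∈ = rep∈range1 (k * x)

corollary2p7 : (p : ℕ) → Prime p → 3 ≤ p → .{{_ : NonZero p}} →
    (k : ℕ) → 1 ≤ k → k < p → Dstar p k ≡ Dstar p 1
corollary2p7 (suc n) p-prime _ k 1≤k k<p =
  Dstar-≡ (suc n) k 1 scale scale-step scale-range1-↭
  where open Scaling n p-prime k (>⇒∤ {{>-nonZero 1≤k}} k<p)
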